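{- There is a left-linear monadic TRS $R$ over a ranked alphabet $\Sigma$ such that $R$ is an EPRF-TRS and $R$ is not a P$\Sigma$R-TRS.
   Context: A ranked alphabet $\Sigma$ is a finite set of symbols with ranks; $X$ a countable set of variables, $T_\Sigma(X)$ the terms, $T_\Sigma$ the ground terms; the height of a variable or constant is $0$. A TRS $R$ over $\Sigma$ is a finite set of rules $l\to r$, $l,r\in T_\Sigma(X)$, with every variable of $r$ occurring in $l$; $sign(R)$ is the set of symbols in its rules; left-linear if no variable occurs twice in a left-hand side; monadic if each left-hand side has height at least $1$ and each right-hand side has height at most $1$. $R^*_\Sigma(L)=\{p\mid q\Rightarrow^*_R p,\ q\in L\}$. A bottom-up tree automaton (bta) over $\Sigma$ is a finite automaton with states (treated as constants), final states, rules $\delta(a_1,\dots,a_n)\to a$ and $a\to a'$, recognizing the ground terms rewriting to a final state; recognizable = recognized by some bta. $R$ is a P$\Sigma$R-TRS if $R^*_\Sigma(L)$ is recognizable for every recognizable $L\subseteq T_\Sigma$. $R$ is an EPRF-TRS if for any given ranked alphabet $\Sigma'\supseteq sign(R)$ and finite $L\subseteq T_{\Sigma'}$ one can effectively construct a bta $\mathcal{C}$ over $\Sigma'$ with $L(\mathcal{C})=R^*_{\Sigma'}(L)$. -}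

module Defs where

open import Data.Nat using (ℕ; zero; suc; _⊔_; _≤_)
open import Data.Fin using (Fin)
open import Data.Vec using (Vec; []; _∷_)
open import Data.List using (List; []; _∷_; _++_)
open import Data.List.Membership.Propositional using (_∈_)
open import Data.List.Relation.Unary.All using (All)
open import Data.List.Relation.Unary.Unique.Propositional using (Unique)
open import Data.Product using (Σ; Σ-syntax; ∃; _×_; _,_; proj₁)
open import Relation.Binary.PropositionalEquality using (_≡_)
open import Relation.Binary.Construct.Closure.ReflexiveTransitive using (Star)

record Symbol : Set where
  constructor sym
  field
    name : ℕ
    rank : ℕ
open Symbol public

Alphabet : Set
Alphabet = List Symbol

-- Terms over all symbols with variables X = ℕ.
data Term : Set where
  var  : ℕ → Term
  node : (f : Symbol) → Vec Term (rank f) → Term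

vars    : Term → List ℕ
varsVec : ∀ {n} → Vec Term n → List ℕ
vars (var x)     = x ∷ []
vars (node f ts) = varsVec ts
varsVec []       = []
varsVec (t ∷ ts) = vars t ++ varsVec ts

syms    : Term → List Symbol
symsVec : ∀ {n} → Vec Term n → List Symbol
syms (var x)     = []
syms (node f ts) = f ∷ symsVec ts
symsVec []       = []
symsVec (t ∷ ts) = syms t ++ symsVec ts

-- height: variables and constants have height 0
height    : Term → ℕ
heightVec : ∀ {n} → Vec Term n → ℕ
height (var x)     = 0
height (node f ts) = heightVec ts
heightVec []       = 0
heightVec (t ∷ ts) = suc (height t) ⊔ heightVec ts

TermOver : Alphabet → Term → Set
TermOver Σ' t = All (_∈ Σ') (syms t)

GroundOver : Alphabet → Term → Set
GroundOver Σ' t = TermOver Σ' t × vars t ≡ []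

subst    : (ℕ → Term) → Term → Term
substVec : ∀ {n} → (ℕ → Term) → Vec Term n → Vec Term n
subst σ (var x)     = σ x
subst σ (node f ts) = node f (substVec σ ts)
substVec σ []       = []
substVec σ (t ∷ ts) = subst σ t ∷ substVec σ ts

record Rule : Set where
  constructor _⟶_∣_
  field
    lhs : Term
    rhs : Term
    rhs-vars : ∀ x → x ∈ vars rhs → x ∈ vars lhs
open Rule public

TRS : Set
TRS = List Rule

InSign : Symbol → TRS → Set
InSign f R = Σ[ ρ ∈ Rule ] (ρ ∈ R × (f ∈ syms (lhs ρ) ++ syms (rhs ρ)))

_SignIn_ : TRS → Alphabet → Set
R SignIn Σ' = ∀ f → InSign f R → f ∈ Σ'

LeftLinear : TRS → Set
LeftLinear R = ∀ ρ → ρ ∈ R → Unique (vars (lhs ρ))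

Monadic : TRS → Set
Monadic R = ∀ ρ → ρ ∈ R → (1 ≤ height (lhs ρ)) × (height (rhs ρ) ≤ 1)

data Step    (R : TRS) : Term → Term → Set
data StepVec (R : TRS) : ∀ {n} → Vec Term n → Vec Term n → Set

data Step R where
  root : ∀ {ρ} → ρ ∈ R → (σ : ℕ → Term) →
         Step R (subst σ (lhs ρ)) (subst σ (rhs ρ))
  arg  : ∀ {f ts us} → StepVec R ts us → Step R (node f ts) (node f us)

data StepVec R where
  here  : ∀ {n t u} {ts : Vec Term n} → Step R t u → StepVec R (t ∷ ts) (u ∷ ts)
  there : ∀ {n t} {ts us : Vec Term n} → StepVec R ts us → StepVec R (t ∷ ts) (t ∷ us)

_⇒*[_]_ : Term → TRS → Term → Set
q ⇒*[ R ] p = Star (Step R) q p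

Lang : Set₁
Lang = Term → Set

LangOver : Alphabet → Lang → Set
LangOver Σ' L = ∀ t → L t → GroundOver Σ' t

_≐_ : Lang → Lang → Set
L ≐ K = ∀ t → (L t → K t) × (K t → L t)

Desc : TRS → Alphabet → Lang → Lang
Desc R Σ' L p = GroundOver Σ' p × (Σ[ q ∈ Term ] (L q × q ⇒*[ R ] p))

record Bta (Σ' : Alphabet) : Set where
  field
    nQ     : ℕ
    final  : List (Fin nQ)
    rules  : List (Σ[ f ∈ Symbol ] (Vec (Fin nQ) (rank f) × Fin nQ))
                                                -- δ(a₁,…,aₙ) → a
    rules-over : All (λ r → proj₁ r ∈ Σ') rules
    eps    : List (Fin nQ × Fin nQ)             -- a → a'

module _ {Σ' : Alphabet} (A : Bta Σ') where
  open Bta A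

  data Reach    : Term → Fin nQ → Set
  data ReachVec : ∀ {n} → Vec Term n → Vec (Fin nQ) n → Set

  data Reach where
    δ-rule : ∀ {f ts as a} → (f , as , a) ∈ rules → ReachVec ts as →
             Reach (node f ts) a
    ε-rule : ∀ {t a a'} → Reach t a → (a , a') ∈ eps → Reach t a'

  data ReachVec where
    []  : ReachVec [] []
    _∷_ : ∀ {n t a} {ts : Vec Term n} {as} →
          Reach t a → ReachVec ts as → ReachVec (t ∷ ts) (a ∷ as)

  Accepted : Lang
  Accepted t = GroundOver Σ' t × (Σ[ a ∈ Fin nQ ] (a ∈ final × Reach t a))

Recognizable : Alphabet → Lang → Set
Recognizable Σ' L = Σ[ C ∈ Bta Σ' ] (Accepted C ≐ L)

PΣR-TRS : Alphabet → TRS → Set₁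
PΣR-TRS Σ' R = (L : Lang) → LangOver Σ' L → Recognizable Σ' L →
               Recognizable Σ' (Desc R Σ' L)

-- effectivity is expressed constructively: a function producing the bta
EPRF-TRS : TRS → Set
EPRF-TRS R = (Σ' : Alphabet) → R SignIn Σ' →
             (L : List Term) → All (GroundOver Σ') L →
             Σ[ C ∈ Bta Σ' ] (Accepted C ≐ Desc R Σ' (_∈ L))

-- The witness is Σ₀ = {f/1, g/2, s/1, a/0} with the single rule  f(x) → g(x,x).
--
-- 1. Descendants are characterised structurally: q ⇒* p iff  q ↠ p, where  ↠
--    keeps every symbol except that an f(t) may become g(u₁,u₂) with t ↠ u₁
--    and t ↠ u₂.  Equivalently, p arises from q by a "root step" (keep the
--    root, or turn f(t) into g(t,t)) followed by descendants at the children.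
-- 2. Not PΣR: the recognisable L₀ = {f(sⁿa)} has descendants containing every
--    g(sⁿa,sⁿa) but no g(sⁱa,sʲa) with i ≠ j.  A pumping argument (pigeonhole
--    on the states reached by the left argument) shows that any bta accepting
--    the whole diagonal accepts an off-diagonal term as well.
-- 3. EPRF: for finite L, take one state per entry of the list of subterms of
--    L, state i standing for the subterm  look i.  The transitions are the
--    f(a₁,…,aₖ) → i such that  look i  root-steps to f(look a₁,…,look aₖ);
--    they are found by filtering a finite list of candidate transitions with a
--    decision procedure for root steps.  By the characterisation in 1, state
--    i then reads exactly the (ground) descendants of  look i.

module Submission where

open import Defs
open import Data.Nat using (ℕ; zero; suc; _<_; z≤n; s≤s) renaming (_≟_ to _≟ℕ_)
open import Data.Nat.Properties using (n<1+n; <-irrefl)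
open import Data.Fin using (Fin; toℕ) renaming (zero to fzero; suc to fsuc)
open import Data.Fin.Properties using (pigeonhole)
open import Data.Vec using (Vec; []; _∷_)
import Data.Vec as Vec
open import Data.Vec.Relation.Unary.All using ([]; _∷_) renaming (All to Allᵥ)
open import Data.Vec.Membership.Propositional using () renaming (_∈_ to _∈ᵥ_)
open import Data.Vec.Relation.Unary.Any using () renaming (here to hereᵥ; there to thereᵥ)
open import Data.List
  using (List; []; _∷_; _++_; length; lookup; filter; concatMap; allFin; cartesianProductWith)
open import Data.List.Relation.Unary.Any using (here; there; index)
import Data.List.Relation.Unary.Any as Any
open import Data.List.Relation.Unary.Any.Properties using (lookup-index)
open import Data.List.Relation.Unary.All using (All; []; _∷_)
import Data.List.Relation.Unary.All as All
import Data.List.Relation.Unary.All.Properties as AllP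
open import Data.List.Relation.Unary.AllPairs using ([]; _∷_)
open import Data.List.Membership.Propositional using (_∈_)
open import Data.List.Membership.Propositional.Properties
  using (∈-++⁺ˡ; ∈-++⁺ʳ; ∈-++⁻; ∈-concatMap⁺; ∈-concatMap⁻; ∈-cartesianProductWith⁺;
         ∈-filter⁺; ∈-filter⁻; ∈-allFin)
open import Data.List.Properties using (++-conicalˡ; ++-conicalʳ)
open import Data.Product using (Σ-syntax; ∃₂; _×_; _,_; proj₁; proj₂)
open import Data.Sum using (inj₁; inj₂)
open import Function using (_∘_)
open import Relation.Binary.PropositionalEquality
  using (_≡_; refl; trans; cong; cong₂)
  renaming (subst to transport; subst₂ to transport₂; sym to ≡-sym)
open import Relation.Binary.Definitions using (DecidableEquality)
open import Relation.Binary.Construct.Closure.ReflexiveTransitive using (Star; ε; _◅_; _◅◅_; gmap)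
open import Relation.Nullary using (¬_; Dec; yes; no)
open import Relation.Nullary.Decidable using (_×-dec_)

fS gS sS aS : Symbol
fS = sym 0 1
gS = sym 1 2
sS = sym 2 1
aS = sym 3 0

F : Term → Term
F t = node fS (t ∷ [])

G : Term → Term → Term
G t u = node gS (t ∷ u ∷ [])

Σ₀ : Alphabet
Σ₀ = fS ∷ gS ∷ sS ∷ aS ∷ []

duplicate : Rule
duplicate = F (var 0) ⟶ G (var 0) (var 0) ∣ rhs⊆lhs
  where
  rhs⊆lhs : ∀ x → x ∈ vars (G (var 0) (var 0)) → x ∈ vars (F (var 0))
  rhs⊆lhs x (here refl)         = here refl
  rhs⊆lhs x (there (here refl)) = here refl

R₀ : TRS
R₀ = duplicate ∷ []

R₀-sign : R₀ SignIn Σ₀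
R₀-sign f (_ , here refl , here refl)         = here refl
R₀-sign f (_ , here refl , there (here refl)) = there (here refl)

R₀-left-linear : LeftLinear R₀
R₀-left-linear ρ (here refl) = [] ∷ []

R₀-monadic : Monadic R₀
R₀-monadic ρ (here refl) = s≤s z≤n , s≤s z≤n

ground-children⁺ : ∀ {A k} {ts : Vec Term k} → Allᵥ (GroundOver A) ts →
                   All (_∈ A) (symsVec ts) × varsVec ts ≡ []
ground-children⁺ []                       = [] , refl
ground-children⁺ ((al , vr) ∷ gs) with ground-children⁺ gs
... | bl , wr = AllP.++⁺ al bl , cong₂ _++_ vr wr

ground-children⁻ : ∀ {A k} (ts : Vec Term k) → All (_∈ A) (symsVec ts) →
                   varsVec ts ≡ [] → Allᵥ (GroundOver A) ts
ground-children⁻ []       _  _  = []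
ground-children⁻ (t ∷ ts) al vr =
  (proj₁ (AllP.++⁻ (syms t) al) , ++-conicalˡ (vars t) _ vr) ∷
  ground-children⁻ ts (proj₂ (AllP.++⁻ (syms t) al)) (++-conicalʳ (vars t) _ vr)

ground-node : ∀ {A f} {ts : Vec Term (rank f)} → f ∈ A → Allᵥ (GroundOver A) ts →
              GroundOver A (node f ts)
ground-node f∈A gs = f∈A ∷ proj₁ (ground-children⁺ gs) , proj₂ (ground-children⁺ gs)

ground-node⁻ : ∀ {A f} {ts : Vec Term (rank f)} → GroundOver A (node f ts) →
               f ∈ A × Allᵥ (GroundOver A) ts
ground-node⁻ {ts = ts} (f∈A ∷ al , vr) = f∈A , ground-children⁻ ts al vr

data _↠_ : Term → Term → Set
data _↠ᵥ_ : ∀ {k} → Vec Term k → Vec Term k → Set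

data _↠_ where
  var↠  : ∀ {x} → var x ↠ var x
  node↠ : ∀ {h ts us} → ts ↠ᵥ us → node h ts ↠ node h us
  dup↠  : ∀ {t u₁ u₂} → t ↠ u₁ → t ↠ u₂ → F t ↠ G u₁ u₂

data _↠ᵥ_ where
  []  : [] ↠ᵥ []
  _∷_ : ∀ {k t u} {ts us : Vec Term k} → t ↠ u → ts ↠ᵥ us → (t ∷ ts) ↠ᵥ (u ∷ us)

infix 4 _↠_ _↠ᵥ_

↠-refl : ∀ t → t ↠ t
↠ᵥ-refl : ∀ {k} (ts : Vec Term k) → ts ↠ᵥ ts
↠-refl (var x)     = var↠
↠-refl (node f ts) = node↠ (↠ᵥ-refl ts)
↠ᵥ-refl []       = []
↠ᵥ-refl (t ∷ ts) = ↠-refl t ∷ ↠ᵥ-refl ts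

-- Composing two structural descendants: a duplication followed by changes
-- to the copies is a duplication of the changed argument, and vice versa.
↠-trans : ∀ {a b c} → a ↠ b → b ↠ c → a ↠ c
↠ᵥ-trans : ∀ {k} {as bs cs : Vec Term k} → as ↠ᵥ bs → bs ↠ᵥ cs → as ↠ᵥ cs
↠-trans var↠                 e                       = e
↠-trans (node↠ ds)           (node↠ es)              = node↠ (↠ᵥ-trans ds es)
↠-trans (node↠ (d ∷ []))     (dup↠ e₁ e₂)           =
  dup↠ (↠-trans d e₁) (↠-trans d e₂)
↠-trans (dup↠ d₁ d₂)         (node↠ (e₁ ∷ e₂ ∷ [])) =
  dup↠ (↠-trans d₁ e₁) (↠-trans d₂ e₂)
↠ᵥ-trans []       []       = []
↠ᵥ-trans (d ∷ ds) (e ∷ es) = ↠-trans d e ∷ ↠ᵥ-trans ds es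

step⇒↠ : ∀ {t u} → Step R₀ t u → t ↠ u
stepᵥ⇒↠ᵥ : ∀ {k} {ts us : Vec Term k} → StepVec R₀ ts us → ts ↠ᵥ us
step⇒↠ (root (here refl) σ) = dup↠ (↠-refl (σ 0)) (↠-refl (σ 0))
step⇒↠ (arg steps)          = node↠ (stepᵥ⇒↠ᵥ steps)
stepᵥ⇒↠ᵥ (here {ts = ts} s) = step⇒↠ s ∷ ↠ᵥ-refl ts
stepᵥ⇒↠ᵥ (there {t = t} s)  = ↠-refl t ∷ stepᵥ⇒↠ᵥ s

⇒*⇒↠ : ∀ {t u} → t ⇒*[ R₀ ] u → t ↠ u
⇒*⇒↠ ε        = ↠-refl _
⇒*⇒↠ (s ◅ ss) = ↠-trans (step⇒↠ s) (⇒*⇒↠ ss)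

-- Conversely, f(t) ↠ g(u₁,u₂) is realised by duplicating first and then
-- rewriting the two copies one after the other.
↠⇒⇒* : ∀ {t u} → t ↠ u → t ⇒*[ R₀ ] u
↠ᵥ⇒⇒* : ∀ {k} {ts us : Vec Term k} → ts ↠ᵥ us → Star (StepVec R₀) ts us
↠⇒⇒* var↠                      = ε
↠⇒⇒* (node↠ {h = h} ds)        = gmap (node h) arg (↠ᵥ⇒⇒* ds)
↠⇒⇒* (dup↠ {t} {u₁} d₁ d₂)     =
  root (here refl) (λ _ → t) ◅
  (gmap (λ x → G x t) (λ s → arg (here s)) (↠⇒⇒* d₁) ◅◅
   gmap (G u₁) (λ s → arg (there (here s))) (↠⇒⇒* d₂))
↠ᵥ⇒⇒* []                                = ε
↠ᵥ⇒⇒* (_∷_ {u = u} {ts = ts} d ds)      =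
  gmap (_∷ ts) here (↠⇒⇒* d) ◅◅ gmap (u ∷_) there (↠ᵥ⇒⇒* ds)

data RootStep : Term → Term → Set where
  root-keep : ∀ {f ts} → RootStep (node f ts) (node f ts)
  root-dup  : ∀ {t} → RootStep (F t) (G t t)

root-then : ∀ {q f us ps} → RootStep q (node f us) → us ↠ᵥ ps → q ↠ node f ps
root-then root-keep ds             = node↠ ds
root-then root-dup  (d₁ ∷ d₂ ∷ []) = dup↠ d₁ d₂

-- The numeral sᵐa; numerals contain no f, so they are R₀-normal forms.
num : ℕ → Term
num zero    = node aS []
num (suc m) = node sS (num m ∷ [])

num-rigid : ∀ m {x} → num m ↠ x → x ≡ num m
num-rigid zero    (node↠ [])       = refl
num-rigid (suc m) (node↠ (d ∷ [])) = cong (λ z → node sS (z ∷ [])) (num-rigid m d)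

num-injective : ∀ {i j} → num i ≡ num j → i ≡ j
num-injective {zero}  {zero}  e = refl
num-injective {suc i} {suc j} e = cong suc (num-injective (cong predecessor e))
  where
  predecessor : Term → Term
  predecessor (node (sym 2 1) (t ∷ [])) = t
  predecessor t                         = t

num-ground : ∀ m → GroundOver Σ₀ (num m)
num-ground zero    = ground-node (there (there (there (here refl)))) []
num-ground (suc m) = ground-node (there (there (here refl))) (num-ground m ∷ [])

L₀ : Lang
L₀ t = Σ[ m ∈ ℕ ] (t ≡ F (num m))

L₀-over : LangOver Σ₀ L₀
L₀-over _ (m , refl) = ground-node (here refl) (num-ground m ∷ [])

-- State 0 reads numerals, state 1 reads f(numeral).
B₀ : Bta Σ₀
B₀ = record
  { nQ         = 2
  ; final      = fsuc fzero ∷ []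
  ; rules      = (aS , [] , fzero) ∷ (sS , fzero ∷ [] , fzero) ∷
                 (fS , fzero ∷ [] , fsuc fzero) ∷ []
  ; rules-over = there (there (there (here refl))) ∷ there (there (here refl)) ∷
                 here refl ∷ []
  ; eps        = []
  }

B₀-invariant : Fin 2 → Term → Set
B₀-invariant fzero    t = Σ[ m ∈ ℕ ] (t ≡ num m)
B₀-invariant (fsuc _) t = L₀ t

B₀-sound : ∀ {t a} → Reach B₀ t a → B₀-invariant a t
B₀-sound (δ-rule (here refl) []) = zero , refl
B₀-sound (δ-rule (there (here refl)) (r ∷ [])) with B₀-sound r
... | m , refl = suc m , refl
B₀-sound (δ-rule (there (there (here refl))) (r ∷ [])) with B₀-sound r
... | m , refl = m , refl

B₀-num : ∀ m → Reach B₀ (num m) fzero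
B₀-num zero    = δ-rule (here refl) []
B₀-num (suc m) = δ-rule (there (here refl)) (B₀-num m ∷ [])

L₀-recognisable : Recognizable Σ₀ L₀
L₀-recognisable = B₀ , λ t → accepted⇒L₀ , L₀⇒accepted
  where
  accepted⇒L₀ : ∀ {t} → Accepted B₀ t → L₀ t
  accepted⇒L₀ (_ , _ , here refl , r) = B₀-sound r

  L₀⇒accepted : ∀ {t} → L₀ t → Accepted B₀ t
  L₀⇒accepted {t} (m , refl) =
    L₀-over t (m , refl) , fsuc fzero , here refl ,
    δ-rule (there (there (here refl))) (B₀-num m ∷ [])

module _ {A : Alphabet} (C : Bta A) where
  open Bta C

  Runs : Term → Set
  Runs t = Σ[ a ∈ Fin nQ ] (a ∈ final × Reach C t a)

  record BinaryRun (t₁ t₂ : Term) (a : Fin nQ) : Set where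
    field
      left      : Fin nQ
      right     : Fin nQ
      left-run  : Reach C t₁ left
      right-run : Reach C t₂ right
      plug      : ∀ {t₁′ t₂′} → Reach C t₁′ left → Reach C t₂′ right →
                  Reach C (G t₁′ t₂′) a

  binary-run : ∀ {t₁ t₂ a} → Reach C (G t₁ t₂) a → BinaryRun t₁ t₂ a
  binary-run (δ-rule {as = b ∷ c ∷ []} ρ∈ (r₁ ∷ r₂ ∷ [])) =
    record { left-run = r₁ ; right-run = r₂
           ; plug = λ r₁′ r₂′ → δ-rule ρ∈ (r₁′ ∷ r₂′ ∷ []) }
  binary-run (ε-rule r e) =
    record { left-run = left-run ; right-run = right-run
           ; plug = λ r₁′ r₂′ → ε-rule (plug r₁′ r₂′) e }
    where open BinaryRun (binary-run r)

  -- If C accepts every g(uₙ,uₙ), two of the nQ + 1 runs on g(u₀,u₀), …,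
  -- g(u_nQ,u_nQ) agree on the left state, so C also accepts some g(uᵢ,uⱼ), i < j.
  diagonal-pumping : (u : ℕ → Term) → (∀ n → Runs (G (u n) (u n))) →
                     Σ[ i ∈ ℕ ] Σ[ j ∈ ℕ ] (i < j × Runs (G (u i) (u j)))
  diagonal-pumping u diagonal = mix (pigeonhole (n<1+n nQ) (left ∘ run ∘ toℕ))
    where
    open BinaryRun

    run : ∀ n → BinaryRun (u n) (u n) (proj₁ (diagonal n))
    run n = binary-run (proj₂ (proj₂ (diagonal n)))

    -- the run on g(uⱼ,uⱼ) with its left argument replaced by uᵢ
    mix : (∃₂ λ i j → toℕ i < toℕ j × left (run (toℕ i)) ≡ left (run (toℕ j))) →
          Σ[ i ∈ ℕ ] Σ[ j ∈ ℕ ] (i < j × Runs (G (u i) (u j)))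
    mix (i , j , i<j , same-left) =
      toℕ i , toℕ j , i<j , proj₁ (diagonal (toℕ j)) , proj₁ (proj₂ (diagonal (toℕ j))) ,
      plug (run (toℕ j))
        (transport (Reach C (u (toℕ i))) same-left (left-run (run (toℕ i))))
        (right-run (run (toℕ j)))

diagonal-descendant : ∀ n → Desc R₀ Σ₀ L₀ (G (num n) (num n))
diagonal-descendant n =
  ground-node (there (here refl)) (num-ground n ∷ num-ground n ∷ []) ,
  F (num n) , (n , refl) , root (here refl) (λ _ → num n) ◅ ε

off-diagonal-excluded : ∀ {i j} → Desc R₀ Σ₀ L₀ (G (num i) (num j)) → i ≡ j
off-diagonal-excluded (_ , _ , (m , refl) , steps) with ⇒*⇒↠ steps
... | dup↠ d₁ d₂ =
  trans (num-injective (num-rigid m d₁)) (≡-sym (num-injective (num-rigid m d₂)))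

-- A bta for the descendants of L₀ accepts the whole diagonal, so by pumping
-- it accepts some g(sⁱa,sʲa) with i < j, which is no descendant.
R₀-not-PΣR : ¬ PΣR-TRS Σ₀ R₀
R₀-not-PΣR preserves with preserves L₀ L₀-over L₀-recognisable
... | C , C≐desc
    with diagonal-pumping C num (λ n → proj₂ (proj₂ (C≐desc _) (diagonal-descendant n)))
... | i , j , i<j , runs =
  <-irrefl (off-diagonal-excluded (proj₁ (C≐desc _) (ground , runs))) i<j
  where
  ground : GroundOver Σ₀ (G (num i) (num j))
  ground = ground-node (there (here refl)) (num-ground i ∷ num-ground j ∷ [])

_≟ˢ_ : DecidableEquality Symbol
sym a k ≟ˢ sym b l with a ≟ℕ b | k ≟ℕ l
... | yes refl | yes refl = yes refl
... | no a≢b   | _        = no λ { refl → a≢b refl }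
... | yes _    | no k≢l   = no λ { refl → k≢l refl }

_≟ᵗ_ : DecidableEquality Term
_≟ᵗˢ_ : ∀ {k} → DecidableEquality (Vec Term k)
var x ≟ᵗ var y with x ≟ℕ y
... | yes refl = yes refl
... | no x≢y   = no λ { refl → x≢y refl }
var _ ≟ᵗ node _ _ = no λ ()
node _ _ ≟ᵗ var _ = no λ ()
node f ts ≟ᵗ node g us with f ≟ˢ g
... | no f≢g = no λ { refl → f≢g refl }
... | yes refl with ts ≟ᵗˢ us
...   | yes refl  = yes refl
...   | no ts≢us  = no λ { refl → ts≢us refl }
[] ≟ᵗˢ [] = yes refl
(t ∷ ts) ≟ᵗˢ (u ∷ us) with t ≟ᵗ u | ts ≟ᵗˢ us
... | yes refl | yes refl = yes refl
... | no t≢u   | _        = no λ { refl → t≢u refl }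
... | yes _    | no ts≢us = no λ { refl → ts≢us refl }

open import Data.List.Membership.DecPropositional _≟ˢ_ using () renaming (_∈?_ to _∈ˢ?_)
open import Data.List.Membership.DecPropositional _≟ᵗ_ using () renaming (_∈?_ to _∈ᵗ?_)

-- If q duplicates into g(t,t), then q = f(t) and t is the first child of q.
first-child : Term → Term
first-child (node (sym _ (suc _)) (t ∷ _)) = t
first-child t                              = t

rootStep? : ∀ q p → Dec (RootStep q p)
rootStep? q p with q ≟ᵗ p
rootStep? (var x)     _ | yes refl = no λ ()
rootStep? (node f ts) _ | yes refl = yes root-keep
... | no q≢p with q ≟ᵗ F (first-child q) ×-dec p ≟ᵗ G (first-child q) (first-child q)
...   | yes (q≡Ft , p≡Gtt) =
  yes (transport₂ RootStep (≡-sym q≡Ft) (≡-sym p≡Gtt) root-dup)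
...   | no not-dup = no λ { root-keep → q≢p refl ; root-dup → not-dup (refl , refl) }

subterms : Term → List Term
subtermsᵥ : ∀ {k} → Vec Term k → List Term
subterms (var x)     = var x ∷ []
subterms (node h ts) = node h ts ∷ subtermsᵥ ts
subtermsᵥ []       = []
subtermsᵥ (t ∷ ts) = subterms t ++ subtermsᵥ ts

subterms-self : ∀ q → q ∈ subterms q
subterms-self (var x)     = here refl
subterms-self (node h ts) = here refl

subtermsᵥ-child : ∀ {k c} {ts : Vec Term k} → c ∈ᵥ ts → c ∈ subtermsᵥ ts
subtermsᵥ-child {c = c} (hereᵥ refl)      = ∈-++⁺ˡ (subterms-self c)
subtermsᵥ-child {ts = t ∷ _} (thereᵥ c∈) = ∈-++⁺ʳ (subterms t) (subtermsᵥ-child c∈)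

subterms-closed : ∀ q {h ts c} → node h ts ∈ subterms q → c ∈ᵥ ts → c ∈ subterms q
subtermsᵥ-closed : ∀ {k} (qs : Vec Term k) {h ts c} →
                   node h ts ∈ subtermsᵥ qs → c ∈ᵥ ts → c ∈ subtermsᵥ qs
subterms-closed (var x)     (here ())   _
subterms-closed (var x)     (there ())  _
subterms-closed (node h ts) (here refl) c∈ = there (subtermsᵥ-child c∈)
subterms-closed (node h ts) (there s∈)  c∈ = there (subtermsᵥ-closed ts s∈ c∈)
subtermsᵥ-closed (q ∷ qs) s∈ c∈ with ∈-++⁻ (subterms q) s∈
... | inj₁ s∈q  = ∈-++⁺ˡ (subterms-closed q s∈q c∈)
... | inj₂ s∈qs = ∈-++⁺ʳ (subterms q) (subtermsᵥ-closed qs s∈qs c∈)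

module DescendantAutomaton (A : Alphabet) (L : List Term) where

  -- One state per entry of the subterm list of L; state i reads the
  -- descendants (ground over A) of the subterm  look i.
  Sub : List Term
  Sub = concatMap subterms L

  n : ℕ
  n = length Sub

  look : Fin n → Term
  look = lookup Sub

  look-index : ∀ {q} (q∈ : q ∈ Sub) → look (index q∈) ≡ q
  look-index q∈ = ≡-sym (lookup-index q∈)

  Sub-from-L : ∀ {q} → q ∈ L → q ∈ Sub
  Sub-from-L q∈L = ∈-concatMap⁺ subterms (Any.map (λ { refl → subterms-self _ }) q∈L)

  Sub-closed : ∀ {h ts c} → node h ts ∈ Sub → c ∈ᵥ ts → c ∈ Sub
  Sub-closed s∈ c∈ =
    ∈-concatMap⁺ subterms
      (Any.map (λ s∈q → subterms-closed _ s∈q c∈) (∈-concatMap⁻ subterms {xs = L} s∈))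

  indices : ∀ {k} (ts : Vec Term k) → (∀ {c} → c ∈ᵥ ts → c ∈ Sub) → Vec (Fin n) k
  indices []       _  = []
  indices (t ∷ ts) cl = index (cl (hereᵥ refl)) ∷ indices ts (cl ∘ thereᵥ)

  look-indices : ∀ {k} (ts : Vec Term k) (cl : ∀ {c} → c ∈ᵥ ts → c ∈ Sub) →
                 Vec.map look (indices ts cl) ≡ ts
  look-indices []       _  = refl
  look-indices (t ∷ ts) cl =
    cong₂ _∷_ (look-index (cl (hereᵥ refl))) (look-indices ts (cl ∘ thereᵥ))

  Transition : Set
  Transition = Σ[ f ∈ Symbol ] (Vec (Fin n) (rank f) × Fin n)

  Admissible : Transition → Set
  Admissible (f , as , i) = f ∈ A × RootStep (look i) (node f (Vec.map look as))

  admissible? : ∀ r → Dec (Admissible r)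
  admissible? (f , as , i) =
    (f ∈ˢ? A) ×-dec rootStep? (look i) (node f (Vec.map look as))

  vectors : ∀ k → List (Vec (Fin n) k)
  vectors zero    = [] ∷ []
  vectors (suc k) = cartesianProductWith _∷_ (allFin n) (vectors k)

  ∈-vectors : ∀ {k} (as : Vec (Fin n) k) → as ∈ vectors k
  ∈-vectors []       = here refl
  ∈-vectors (a ∷ as) = ∈-cartesianProductWith⁺ _∷_ (∈-allFin a) (∈-vectors as)

  candidates : List Transition
  candidates =
    concatMap (λ f → cartesianProductWith (λ as i → f , as , i) (vectors (rank f)) (allFin n)) A

  ∈-candidates : ∀ {f as i} → f ∈ A → (f , as , i) ∈ candidates
  ∈-candidates {as = as} {i} f∈A = ∈-concatMap⁺ _
    (Any.map (λ { refl → ∈-cartesianProductWith⁺ _ (∈-vectors as) (∈-allFin i) }) f∈A)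

  transitions : List Transition
  transitions = filter admissible? candidates

  transition-sound : ∀ {r} → r ∈ transitions → Admissible r
  transition-sound r∈ = proj₂ (∈-filter⁻ admissible? {xs = candidates} r∈)

  transition-complete : ∀ {f as i q us} → f ∈ A → look i ≡ q → Vec.map look as ≡ us →
                        RootStep q (node f us) → (f , as , i) ∈ transitions
  transition-complete f∈A refl refl step =
    ∈-filter⁺ admissible? (∈-candidates f∈A) (f∈A , step)

  final? : ∀ i → Dec (look i ∈ L)
  final? i = look i ∈ᵗ? L

  C : Bta A
  C = record
    { nQ         = n
    ; final      = filter final? (allFin n)
    ; rules      = transitions
    ; rules-over = All.map proj₁ (AllP.all-filter admissible? candidates)
    ; eps        = []
    }

  sound : ∀ {p i} → Reach C p i → look i ↠ p
  soundᵥ : ∀ {k} {ps : Vec Term k} {as} → ReachVec C ps as → Vec.map look as ↠ᵥ ps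
  sound (δ-rule r∈ rs) = root-then (proj₂ (transition-sound r∈)) (soundᵥ rs)
  soundᵥ []       = []
  soundᵥ (r ∷ rs) = sound r ∷ soundᵥ rs

  complete : ∀ {q p} → q ↠ p → GroundOver A p → q ∈ Sub → ∀ i → look i ≡ q → Reach C p i
  completeᵥ : ∀ {k} {ts us : Vec Term k} → ts ↠ᵥ us → Allᵥ (GroundOver A) us →
              (cl : ∀ {c} → c ∈ᵥ ts → c ∈ Sub) → ReachVec C us (indices ts cl)
  complete var↠ (_ , ()) _ _ _
  complete (node↠ {ts = ts} ds) ground q∈ i i↦q with ground-node⁻ ground
  ... | h∈A , grounds =
    δ-rule (transition-complete h∈A i↦q (look-indices ts (Sub-closed q∈)) root-keep)
           (completeᵥ ds grounds (Sub-closed q∈))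
  complete (dup↠ {u₁ = u₁} {u₂} d₁ d₂) ground q∈ i i↦q
    with ground-node⁻ {ts = u₁ ∷ u₂ ∷ []} ground
  ... | g∈A , g₁ ∷ g₂ ∷ [] =
    δ-rule (transition-complete g∈A i↦q (cong (λ t → t ∷ t ∷ []) (look-index t∈)) root-dup)
           (complete d₁ g₁ t∈ _ (look-index t∈) ∷ complete d₂ g₂ t∈ _ (look-index t∈) ∷ [])
    where t∈ = Sub-closed q∈ (hereᵥ refl)
  completeᵥ []       []       _  = []
  completeᵥ (d ∷ ds) (g ∷ gs) cl =
    complete d g t∈ _ (look-index t∈) ∷ completeᵥ ds gs (cl ∘ thereᵥ)
    where t∈ = cl (hereᵥ refl)

  correct : Accepted C ≐ Desc R₀ A (_∈ L)
  correct t = accepted⇒descendant , descendant⇒accepted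
    where
    accepted⇒descendant : Accepted C t → Desc R₀ A (_∈ L) t
    accepted⇒descendant (ground , i , i-final , run) =
      ground , look i , proj₂ (∈-filter⁻ final? {xs = allFin n} i-final) , ↠⇒⇒* (sound run)

    descendant⇒accepted : Desc R₀ A (_∈ L) t → Accepted C t
    descendant⇒accepted (ground , q , q∈L , steps) =
      ground , index q∈ ,
      ∈-filter⁺ final? (∈-allFin _) (transport (_∈ L) (≡-sym (look-index q∈)) q∈L) ,
      complete (⇒*⇒↠ steps) ground q∈ _ (look-index q∈)
      where q∈ = Sub-from-L q∈L

R₀-EPRF : EPRF-TRS R₀
R₀-EPRF A _ L _ = C , correct
  where open DescendantAutomaton A L

mainTheorem14 : Σ[ Σ' ∈ Alphabet ] Σ[ R ∈ TRS ]
    (R SignIn Σ' × LeftLinear R × Monadic R × EPRF-TRS R × ¬ PΣR-TRS Σ' R)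
mainTheorem14 = Σ₀ , R₀ , R₀-sign , R₀-left-linear , R₀-monadic , R₀-EPRF , R₀-not-PΣR
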